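{- Let $G_0,G_1,G_2$ be matching covered graphs, let $v_1v_2\in E(G_0)$, and let $u_1\in V(G_1)$, $u_2\in V(G_2)$ with $d_{G_1}(u_1)=d_{G_0}(v_1)$ and $d_{G_2}(u_2)=d_{G_0}(v_2)$. Let $G=(G_0(v_1)\odot G_1(u_1))(v_2)\odot G_2(u_2)$. For $i=1,2$, let $E_i$ be the set of edges of $E(G_i)\setminus\partial_{G_i}(\{u_i\})$ that are removable in $G_0(v_i)\odot G_i(u_i)$. Then every edge of $E_1\cup E_2$ is removable in $G$.
   Context: All graphs are finite, simple and undirected. A connected graph is matching covered if every edge lies in some perfect matching; an edge $e$ of a matching covered graph is removable if deleting it leaves a matching covered graph. $\partial_{G}(\{u\})$ is the set of edges incident with $u$. For vertex-disjoint graphs $G,H$, vertices $u\in V(G)$, $v\in V(H)$ of the same degree $d$ with neighbours $u_1,\dots,u_d$ and $v_1,\dots,v_d$ (in some fixed correspondence), the splicing $G(u)\odot H(v)$ is obtained from $G-u$ and $H-v$ by adding the edges $u_iv_i$, $i=1,\dots,d$. Edges and vertices of a splicing other than the new edges are identified with those of the original graphs. -}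

module Defs where

open import Data.Bool using (Bool; true; false; not; _∧_; _∨_; T)
open import Data.Bool.Properties using (∧-comm; ∨-comm)
open import Data.Unit using (tt)
open import Data.Nat using (ℕ)
open import Data.Fin using (Fin)
open import Data.Sum using (_⊎_; inj₁; inj₂)
open import Data.Product using (Σ; _,_; proj₁; proj₂; _×_)
open import Data.Empty using (⊥; ⊥-elim)
open import Relation.Binary.PropositionalEquality
open import Relation.Binary.Definitions using (DecidableEquality)
open import Relation.Nullary using (Dec; yes; no; ¬_)
open import Relation.Nullary.Decidable using (⌊_⌋)
open import Function.Bundles using (_↔_)

-- Finiteness is a
-- separate predicate ('Finite') assumed in the theorem for the input graphs.

record Graph : Set₁ where
  field
    V          : Set
    _≟_        : DecidableEquality V
    adj        : V → V → Bool
    adj-sym    : ∀ x y → adj x y ≡ adj y x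
    adj-irrefl : ∀ x → adj x x ≡ false

open Graph public

Adj : (G : Graph) → V G → V G → Set
Adj G x y = T (adj G x y)

Finite : Graph → Set
Finite G = Σ ℕ λ n → V G ↔ Fin n

_≠[_]_ : {G : Graph} → V G → (G' : Graph) → V G → Bool
_≠[_]_ {G} x _ y = not ⌊ (_≟_ G) x y ⌋

data Reach (G : Graph) : V G → V G → Set where
  here : ∀ {x} → Reach G x x
  step : ∀ {x y z} → Adj G x y → Reach G y z → Reach G x z

Connected : Graph → Set
Connected G = ∀ x y → Reach G x y

-- Perfect matchings, given by the partner function m: every vertex x is
-- covered by exactly the matching edge x (m x).

PerfectMatching : Graph → Set
PerfectMatching G =
  Σ (V G → V G) λ m → (∀ x → Adj G x (m x)) × (∀ x → m (m x) ≡ x)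

InSomePM : (G : Graph) → V G → V G → Set
InSomePM G x y = Σ (PerfectMatching G) λ M → proj₁ M x ≡ y

MatchingCovered : Graph → Set
MatchingCovered G =
  Connected G
  × (Σ (V G) λ x → Σ (V G) λ y → Adj G x y)
  × (∀ x y → Adj G x y → InSomePM G x y)

module _ (G : Graph) (a b : V G) where
  private
    eq : V G → V G → Bool
    eq x y = ⌊ (_≟_ G) x y ⌋

    isE : V G → V G → Bool
    isE x y = (eq x a ∧ eq y b) ∨ (eq x b ∧ eq y a)

    isE-sym : ∀ x y → isE x y ≡ isE y x
    isE-sym x y rewrite ∧-comm (eq x a) (eq y b) | ∧-comm (eq x b) (eq y a)
      = ∨-comm (eq y b ∧ eq x a) (eq y a ∧ eq x b)

    dadj : V G → V G → Bool
    dadj x y = adj G x y ∧ not (isE x y)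

    dsym : ∀ x y → dadj x y ≡ dadj y x
    dsym x y rewrite adj-sym G x y | isE-sym x y = refl

    dirr : ∀ x → dadj x x ≡ false
    dirr x rewrite adj-irrefl G x = refl

  deleteEdge : Graph
  deleteEdge = record
    { V = V G ; _≟_ = _≟_ G ; adj = dadj ; adj-sym = dsym ; adj-irrefl = dirr }

Removable : (G : Graph) → V G → V G → Set
Removable G a b = Adj G a b × MatchingCovered (deleteEdge G a b)

-- The correspondence between the neighbours of u
-- and those of v is given by a map f : V G → V H, of which only the
-- restriction to the neighbourhood of u matters; 'Correspondence' requires
-- this restriction to be a bijection onto the neighbourhood of v (so in
-- particular d_G(u) = d_H(v)).

Sub : (G : Graph) → V G → Set
Sub G u = Σ (V G) λ x → T (not ⌊ (_≟_ G) x u ⌋)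

Correspondence : (G : Graph) → V G → (H : Graph) → V H → (V G → V H) → Set
Correspondence G u H v f =
  (∀ x → Adj G u x → Adj H v (f x))
  × (∀ x y → Adj G u x → Adj G u y → f x ≡ f y → x ≡ y)
  × (∀ y → Adj H v y → Σ (V G) λ x → Adj G u x × f x ≡ y)

private
  T-irr : ∀ {b} (p q : T b) → p ≡ q
  T-irr {true} tt tt = refl

  Sub-≟ : (G : Graph) (u : V G) → DecidableEquality (Sub G u)
  Sub-≟ G u (x , p) (y , q) with (_≟_ G) x y
  ... | yes refl = yes (cong (x ,_) (T-irr p q))
  ... | no x≢y = no λ e → x≢y (cong proj₁ e)

  ⊎-≟ : {A B : Set} → DecidableEquality A → DecidableEquality B
      → DecidableEquality (A ⊎ B)
  ⊎-≟ da db (inj₁ x) (inj₁ y) with da x y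
  ... | yes refl = yes refl
  ... | no ne = no λ { refl → ne refl }
  ⊎-≟ da db (inj₂ x) (inj₂ y) with db x y
  ... | yes refl = yes refl
  ... | no ne = no λ { refl → ne refl }
  ⊎-≟ da db (inj₁ x) (inj₂ y) = no λ ()
  ⊎-≟ da db (inj₂ x) (inj₁ y) = no λ ()

module _ (G : Graph) (u : V G) (H : Graph) (v : V H) (f : V G → V H) where
  private
    SV : Set
    SV = Sub G u ⊎ Sub H v

    sadj : SV → SV → Bool
    sadj (inj₁ (x , _)) (inj₁ (y , _)) = adj G x y
    sadj (inj₂ (x , _)) (inj₂ (y , _)) = adj H x y
    sadj (inj₁ (x , _)) (inj₂ (y , _)) = adj G u x ∧ adj H v y ∧ ⌊ (_≟_ H) (f x) y ⌋
    sadj (inj₂ (y , _)) (inj₁ (x , _)) = adj G u x ∧ adj H v y ∧ ⌊ (_≟_ H) (f x) y ⌋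

    ssym : ∀ x y → sadj x y ≡ sadj y x
    ssym (inj₁ (x , _)) (inj₁ (y , _)) = adj-sym G x y
    ssym (inj₂ (x , _)) (inj₂ (y , _)) = adj-sym H x y
    ssym (inj₁ _) (inj₂ _) = refl
    ssym (inj₂ _) (inj₁ _) = refl

    sirr : ∀ x → sadj x x ≡ false
    sirr (inj₁ (x , _)) = adj-irrefl G x
    sirr (inj₂ (x , _)) = adj-irrefl H x

  splice : Graph
  splice = record
    { V = SV ; _≟_ = ⊎-≟ (Sub-≟ G u) (Sub-≟ H v)
    ; adj = sadj ; adj-sym = ssym ; adj-irrefl = sirr }

adj⇒≠ : (G : Graph) (x y : V G) → Adj G x y → T (not ⌊ (_≟_ G) y x ⌋)
adj⇒≠ G x y e with (_≟_ G) y x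
... | yes refl rewrite adj-irrefl G x = ⊥-elim e
... | no _ = tt

module _ (G0 G1 G2 : Graph) (v1 v2 : V G0) (e : Adj G0 v1 v2)
         (u1 : V G1) (u2 : V G2)
         (f1 : V G0 → V G1) (f2 : V G0 → V G2) where

  H₁ : Graph
  H₁ = splice G0 v1 G1 u1 f1

  v2' : V H₁
  v2' = inj₁ (v2 , adj⇒≠ G0 v1 v2 e)

  -- induced correspondence between neighbours of v2 in H and of u2 in G2:
  -- a neighbour w ≠ v1 of v2 in G0 keeps its partner f2 w; the G1-vertex
  -- that replaced v1 (namely f1 v2) gets the partner f2 v1.
  f2' : V H₁ → V G2
  f2' (inj₁ (x , _)) = f2 x
  f2' (inj₂ _) = f2 v1

  doubleSplice : Graph
  doubleSplice = splice H₁ v2' G2 u2 f2'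

  emb₁ : Sub G1 u1 → V doubleSplice
  emb₁ a = inj₁ (inj₂ a , tt)

  emb₂ : Sub G2 u2 → V doubleSplice
  emb₂ a = inj₂ a

{-# OPTIONS --safe #-}
-- Write G = H(v2) ⊙ G2(u2) with H = G0(v1) ⊙ G1(u1). An edge ab of G1 - u1 lies in H - v2,
-- and deleting it commutes with the second splicing: G - ab = (H - ab)(v2) ⊙ G2(u2). As H - ab
-- is matching covered, it suffices that splicing two matching covered graphs gives a matching
-- covered graph. Perfect matchings of the two sides that use corresponding edges at the
-- spliced vertices glue to a perfect matching of the splice, so every edge lies in one.
-- Connectivity needs that two neighbours b, c of v in a finite matching covered graph are
-- joined avoiding v: with perfect matchings M ∋ vb and M′ ∋ vc, follow the walk alternating
-- M- and M′-edges from c until it reaches b. Edges of G2 are handled by exchanging the order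
-- of the two splicings. Only G1 and G2 need to be finite and matching covered.
module Submission where

open import Defs
open import Data.Bool using (Bool; true; false; not; _∧_; _∨_; T)
open import Data.Bool.Properties using (T-∧; T-∨; T-irrelevant)
open import Data.Empty using (⊥-elim)
open import Data.Fin using (toℕ)
open import Data.Fin.Properties using (pigeonhole)
open import Data.Nat using (ℕ; zero; suc; _+_)
open import Data.Nat.GeneralisedArithmetic using (fold; fold-+)
open import Data.Nat.Properties using (+-comm; +-suc; n<1+n; m≤n⇒∃[o]m+o≡n)
open import Data.Product as Product using (Σ; _,_; proj₁; proj₂; _×_)
open import Data.Sum as Sum using (_⊎_; inj₁; inj₂; [_,_])
open import Data.Sum.Properties using (inj₁-injective)
open import Function using (_∘_; id)
open import Function.Bundles using (_⇔_; Equivalence; mk⇔; Inverse; Injection)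
open import Function.Properties.Inverse using (↔⇒↣)
open import Relation.Binary.PropositionalEquality hiding ([_])
open import Relation.Nullary using (Dec; yes; no; ¬_)
open import Relation.Nullary.Decidable
  using (⌊_⌋; map′; toWitness; fromWitness; toWitnessFalse; fromWitnessFalse)

Sub-≡ : {G : Graph} {u : V G} {x y : Sub G u} → proj₁ x ≡ proj₁ y → x ≡ y
Sub-≡ {x = x , p} {y = .x , q} refl = cong (x ,_) (T-irrelevant p q)

Sub-≢ : {G : Graph} {u : V G} (x : Sub G u) → proj₁ x ≢ u
Sub-≢ {G} {u} (x , p) = toWitnessFalse {a? = (_≟_ G) x u} p

sub : (G : Graph) {u x : V G} → x ≢ u → Sub G u
sub G {u} {x} x≢u = x , fromWitnessFalse {a? = (_≟_ G) x u} x≢u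

Adj-sym : (G : Graph) {x y : V G} → Adj G x y → Adj G y x
Adj-sym G {x} {y} = subst T (adj-sym G x y)

Adj-irrefl : (G : Graph) {x y : V G} → Adj G x y → x ≢ y
Adj-irrefl G {x} xy refl = subst T (adj-irrefl G x) xy

involutive⇒injective : {A : Set} {g : A → A} → (∀ x → g (g x) ≡ x)
  → ∀ {x y} → g x ≡ g y → x ≡ y
involutive⇒injective {g = g} inv {x} {y} gx≡gy =
  trans (sym (inv x)) (trans (cong g gx≡gy) (inv y))

Reach-trans : (G : Graph) {x y z : V G} → Reach G x y → Reach G y z → Reach G x z
Reach-trans G here q = q
Reach-trans G (step xy p) q = step xy (Reach-trans G p q)

Reach-snoc : (G : Graph) {x y z : V G} → Reach G x y → Adj G y z → Reach G x z
Reach-snoc G p yz = Reach-trans G p (step yz here)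

Reach-sym : (G : Graph) {x y : V G} → Reach G x y → Reach G y x
Reach-sym G here = here
Reach-sym G (step xy p) = Reach-snoc G (Reach-sym G p) (Adj-sym G xy)

Homomorphism : (A B : Graph) → (V A → V B) → Set
Homomorphism A B g = ∀ {x y} → Adj A x y → Adj B (g x) (g y)

Reach-map : {A B : Graph} (g : V A → V B) → Homomorphism A B g
  → ∀ {x y} → Reach A x y → Reach B (g x) (g y)
Reach-map g hom here = here
Reach-map g hom (step xy p) = step (hom xy) (Reach-map g hom p)

deleteVertex : (G : Graph) → V G → Graph
deleteVertex G u = record
  { V = Sub G u
  ; _≟_ = λ x y → map′ (Sub-≡ {G} {u}) (cong proj₁) ((_≟_ G) (proj₁ x) (proj₁ y))
  ; adj = λ x y → adj G (proj₁ x) (proj₁ y)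
  ; adj-sym = λ x y → adj-sym G (proj₁ x) (proj₁ y)
  ; adj-irrefl = λ x → adj-irrefl G (proj₁ x)
  }

Reach-deleteVertex-cong : (G : Graph) (u : V G) {x x′ y y′ : Sub G u}
  → proj₁ x ≡ proj₁ x′ → proj₁ y ≡ proj₁ y′
  → Reach (deleteVertex G u) x y → Reach (deleteVertex G u) x′ y′
Reach-deleteVertex-cong G u x≡x′ y≡y′ =
  subst₂ (Reach (deleteVertex G u)) (Sub-≡ {G} x≡x′) (Sub-≡ {G} y≡y′)

reach-neighbour : (G : Graph) (u : V G) (x : Sub G u) → Reach G (proj₁ x) u
  → Σ (V G) λ a → Σ (Adj G u a) λ ua → Reach (deleteVertex G u) x (a , adj⇒≠ G u a ua)
reach-neighbour G u x here = ⊥-elim (Sub-≢ {G} x refl)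
reach-neighbour G u (x , p) (step {y = y} xy r) with (_≟_ G) y u
... | yes refl = x , Adj-sym G xy , Reach-deleteVertex-cong G u {x , p} {y = x , p} refl refl here
... | no y≢u with reach-neighbour G u (sub G {u} {y} y≢u) r
...   | a , ua , r′ = a , ua , step xy r′

PM-adj : (G : Graph) (M : PerfectMatching G) → ∀ x → Adj G x (proj₁ M x)
PM-adj G M = proj₁ (proj₂ M)

PM-involutive : (G : Graph) (M : PerfectMatching G) → ∀ x → proj₁ M (proj₁ M x) ≡ x
PM-involutive G M = proj₂ (proj₂ M)

record _≅_ (A B : Graph) : Set where
  field
    to       : V A → V B
    from     : V B → V A
    to-from  : ∀ y → to (from y) ≡ y
    from-to  : ∀ x → from (to x) ≡ x
    to-hom   : Homomorphism A B to
    from-hom : Homomorphism B A from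

  to-injective : ∀ {x y} → to x ≡ to y → x ≡ y
  to-injective {x} {y} tx≡ty = trans (sym (from-to x)) (trans (cong from tx≡ty) (from-to y))

module _ {A B : Graph} (I : A ≅ B) where
  open _≅_ I

  PerfectMatching-≅ : PerfectMatching A → PerfectMatching B
  PerfectMatching-≅ (m , m-adj , m-inv) = m′ , m′-adj , m′-inv
    where
      m′ : V B → V B
      m′ y = to (m (from y))
      m′-adj : ∀ y → Adj B y (m′ y)
      m′-adj y = subst (λ z → Adj B z (m′ y)) (to-from y) (to-hom (m-adj (from y)))
      m′-inv : ∀ y → m′ (m′ y) ≡ y
      m′-inv y = begin
        to (m (from (to (m (from y))))) ≡⟨ cong (to ∘ m) (from-to (m (from y))) ⟩
        to (m (m (from y)))             ≡⟨ cong to (m-inv (from y)) ⟩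
        to (from y)                     ≡⟨ to-from y ⟩
        y                               ∎
        where open ≡-Reasoning

  MatchingCovered-≅ : MatchingCovered A → MatchingCovered B
  MatchingCovered-≅ (conn , (x , y , xy) , inPM) = conn′ , (to x , to y , to-hom xy) , inPM′
    where
      conn′ : Connected B
      conn′ x y = subst₂ (Reach B) (to-from x) (to-from y) (Reach-map to to-hom (conn (from x) (from y)))
      inPM′ : ∀ x y → Adj B x y → InSomePM B x y
      inPM′ x y xy =
        let (M , Mx≡y) = inPM (from x) (from y) (from-hom xy) in
        PerfectMatching-≅ M , trans (cong to Mx≡y) (to-from y)

T-not : ∀ {b} → T (not b) ⇔ (¬ T b)
T-not {true}  = mk⇔ (λ ()) (λ ¬t → ¬t _)
T-not {false} = mk⇔ (λ _ ()) (λ _ → _)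

True-× : {P Q : Set} (p? : Dec P) (q? : Dec Q) → T (⌊ p? ⌋ ∧ ⌊ q? ⌋) ⇔ (P × Q)
True-× p? q? = mk⇔
  (λ t → let (a , b) = Equivalence.to T-∧ t in toWitness {a? = p?} a , toWitness {a? = q?} b)
  (λ (a , b) → Equivalence.from T-∧ (fromWitness {a? = p?} a , fromWitness {a? = q?} b))

SameEdge : {A : Set} → A → A → A → A → Set
SameEdge x y p q = (p ≡ x × q ≡ y) ⊎ (p ≡ y × q ≡ x)

SameEdge-map : {A B : Set} (g : A → B) {x y p q : A}
  → SameEdge x y p q → SameEdge (g x) (g y) (g p) (g q)
SameEdge-map g = Sum.map (Product.map (cong g) (cong g)) (Product.map (cong g) (cong g))

SameEdge-reflect : {A B : Set} {g : A → B} → (∀ {a b} → g a ≡ g b → a ≡ b) → {x y p q : A}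
  → SameEdge (g x) (g y) (g p) (g q) → SameEdge x y p q
SameEdge-reflect inj = Sum.map (Product.map inj inj) (Product.map inj inj)

Adj-deleteEdge : (G : Graph) (x y p q : V G)
  → Adj (deleteEdge G x y) p q ⇔ (Adj G p q × ¬ SameEdge x y p q)
Adj-deleteEdge G x y p q = mk⇔
  (λ t → let (pq , ¬e) = Equivalence.to T-∧ t in
    pq , λ s → Equivalence.to T-not ¬e (Equivalence.from same s))
  (λ (pq , ¬s) → Equivalence.from T-∧ (pq , Equivalence.from T-not (¬s ∘ Equivalence.to same)))
  where
    open Graph G using () renaming (_≟_ to _≟G_)
    same : T ((⌊ p ≟G x ⌋ ∧ ⌊ q ≟G y ⌋) ∨ (⌊ p ≟G y ⌋ ∧ ⌊ q ≟G x ⌋)) ⇔ SameEdge x y p q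
    same = mk⇔
      (Sum.map (Equivalence.to xy?) (Equivalence.to yx?) ∘ Equivalence.to T-∨)
      (Equivalence.from T-∨ ∘ Sum.map (Equivalence.from xy?) (Equivalence.from yx?))
      where
        xy? : T (⌊ p ≟G x ⌋ ∧ ⌊ q ≟G y ⌋) ⇔ (p ≡ x × q ≡ y)
        xy? = True-× (p ≟G x) (q ≟G y)
        yx? : T (⌊ p ≟G y ⌋ ∧ ⌊ q ≟G x ⌋) ⇔ (p ≡ y × q ≡ x)
        yx? = True-× (p ≟G y) (q ≟G x)

Adj-deleteEdge-away : (G : Graph) {x y w q : V G} → w ≢ x → w ≢ y
  → Adj (deleteEdge G x y) w q ⇔ Adj G w q
Adj-deleteEdge-away G {x} {y} {w} {q} w≢x w≢y = mk⇔
  (proj₁ ∘ Equivalence.to (Adj-deleteEdge G x y w q))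
  (λ wq → Equivalence.from (Adj-deleteEdge G x y w q) (wq , [ w≢x ∘ proj₁ , w≢y ∘ proj₁ ]))

module _ {A B : Graph} (I : A ≅ B) where
  open _≅_ I

  deleteEdge-≅ : (x y : V A) → deleteEdge A x y ≅ deleteEdge B (to x) (to y)
  deleteEdge-≅ x y = record
    { to = to ; from = from ; to-from = to-from ; from-to = from-to
    ; to-hom = λ {p} {q} pq → let (pq′ , ¬s) = Equivalence.to (Adj-deleteEdge A x y p q) pq in
        Equivalence.from (Adj-deleteEdge B (to x) (to y) (to p) (to q))
          (to-hom pq′ , ¬s ∘ SameEdge-reflect to-injective)
    ; from-hom = λ {p} {q} pq → let (pq′ , ¬s) = Equivalence.to (Adj-deleteEdge B (to x) (to y) p q) pq in
        Equivalence.from (Adj-deleteEdge A x y (from p) (from q))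
          (from-hom pq′ , ¬s ∘ subst₂ (SameEdge (to x) (to y)) (to-from p) (to-from q) ∘ SameEdge-map to)
    }

  Removable-≅ : ∀ {x y} → Removable A x y → Removable B (to x) (to y)
  Removable-≅ {x} {y} (xy , mc) = to-hom xy , MatchingCovered-≅ (deleteEdge-≅ x y) mc

module AlternatingWalk (H : Graph) (v : V H) (M M′ : PerfectMatching H) where
  private
    open Graph H using () renaming (_≟_ to _≟H_)

    μ μ′ σ : V H → V H
    μ = proj₁ M
    μ′ = proj₁ M′
    σ = μ′ ∘ μ

    σ^ : ℕ → V H → V H
    σ^ n x = fold x σ n

    b c : V H
    b = μ v
    c = μ′ v

    D : Graph
    D = deleteVertex H v

    b′ c′ : V D
    b′ = b , adj⇒≠ H v b (PM-adj H M v)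
    c′ = c , adj⇒≠ H v c (PM-adj H M′ v)

    μ-injective : ∀ {x y} → μ x ≡ μ y → x ≡ y
    μ-injective = involutive⇒injective {g = μ} (PM-involutive H M)

    μ′-injective : ∀ {x y} → μ′ x ≡ μ′ y → x ≡ y
    μ′-injective = involutive⇒injective {g = μ′} (PM-involutive H M′)

    σ-injective : ∀ {x y} → σ x ≡ σ y → x ≡ y
    σ-injective = μ-injective ∘ μ′-injective

    σ^-injective : ∀ n {x y} → σ^ n x ≡ σ^ n y → x ≡ y
    σ^-injective zero    = id
    σ^-injective (suc n) = σ^-injective n ∘ σ-injective

    σ^-suc : ∀ n x → σ^ (suc n) x ≡ σ^ n (σ x)
    σ^-suc n x = trans (cong (λ m → σ^ m x) (+-comm 1 n)) (fold-+ x σ n)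

    -- μ′ reverses σ, so μ′ x = σ^(n+2) x pushes down to μ′ (σ x) = σ^n (σ x);
    -- the two base cases are excluded because μ and μ′ have no fixed points.
    μ′≢σ^ : ∀ n x → μ′ x ≢ σ^ n x
    μ′≢σ^ zero x μ′x≡x = Adj-irrefl H (PM-adj H M′ x) (sym μ′x≡x)
    μ′≢σ^ (suc zero) x μ′x≡σx = Adj-irrefl H (PM-adj H M x) (μ′-injective μ′x≡σx)
    μ′≢σ^ (suc (suc n)) x μ′x≡ = μ′≢σ^ n (σ x) (begin
      μ′ (σ x)         ≡⟨ PM-involutive H M′ (μ x) ⟩
      μ x              ≡⟨ cong μ x≡μt ⟩
      μ (μ t)          ≡⟨ PM-involutive H M t ⟩
      t                ∎)
      where
        open ≡-Reasoning
        t : V H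
        t = σ^ n (σ x)
        x≡μt : x ≡ μ t
        x≡μt = μ′-injective (trans μ′x≡ (cong σ (σ^-suc n x)))

    orbit-avoids : ∀ s → σ^ s c ≢ v
    orbit-avoids s σ^sc≡v = μ′≢σ^ s c (trans (PM-involutive H M′ v) (sym σ^sc≡v))

    σb≡c : σ b ≡ c
    σb≡c = cong μ′ (PM-involutive H M v)

    -- σ permutes the finite set V H, so the orbit of c comes back to c = σ b.
    orbit-returns : Finite H → Σ ℕ λ d → σ^ d c ≡ b
    orbit-returns (n , V↔Fin) with pigeonhole (n<1+n n) (Inverse.to V↔Fin ∘ λ i → σ^ (toℕ i) c)
    ... | i , j , i<j , same with m≤n⇒∃[o]m+o≡n i<j
    ...   | k , 1+i+k≡j = k , σ-injective (trans (sym c≡σσ^kc) (sym σb≡c))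
      where
        open ≡-Reasoning
        c≡σσ^kc : c ≡ σ (σ^ k c)
        c≡σσ^kc = σ^-injective (toℕ i) (begin
          σ^ (toℕ i) c           ≡⟨ Injection.injective (↔⇒↣ V↔Fin) same ⟩
          σ^ (toℕ j) c           ≡⟨ cong (λ m → σ^ m c) (sym 1+i+k≡j) ⟩
          σ^ (suc (toℕ i + k)) c ≡⟨ cong (λ m → σ^ m c) (sym (+-suc (toℕ i) k)) ⟩
          σ^ (toℕ i + suc k) c   ≡⟨ fold-+ c σ (toℕ i) ⟩
          σ^ (toℕ i) (σ (σ^ k c)) ∎)

    -- The walk c, μ c, σ c, μ (σ c), ... must stop at b, whose M-partner is v.
    orbit-walk : ∀ s → Reach D c′ b′ ⊎ Reach D c′ (sub H (orbit-avoids s))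
    orbit-walk zero = inj₂ (Reach-deleteVertex-cong H v {c′} {y = c′} refl refl here)
    orbit-walk (suc s) with orbit-walk s
    ... | inj₁ c→b = inj₁ c→b
    ... | inj₂ c→y with σ^ s c ≟H b
    ...   | yes y≡b = inj₁ (Reach-deleteVertex-cong H v refl y≡b c→y)
    ...   | no y≢b  = inj₂ (Reach-snoc D (Reach-snoc D {z = μy} c→y (PM-adj H M y)) (PM-adj H M′ (μ y)))
      where
        y : V H
        y = σ^ s c
        μy : V D
        μy = sub H (λ μy≡v → y≢b (trans (sym (PM-involutive H M y)) (cong μ μy≡v)))

  alternating-walk : Finite H → Reach D c′ b′
  alternating-walk fin =
    let (d , σ^dc≡b) = orbit-returns fin in
    [ id , Reach-deleteVertex-cong H v refl σ^dc≡b ] (orbit-walk d)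

neighbours-linked : (H : Graph) → Finite H → MatchingCovered H
  → {v b c : V H} (vb : Adj H v b) (vc : Adj H v c)
  → Reach (deleteVertex H v) (b , adj⇒≠ H v b vb) (c , adj⇒≠ H v c vc)
neighbours-linked H fin (_ , _ , inPM) {v} {b} {c} vb vc =
  let (M , Mv≡c) = inPM v c vc
      (M′ , M′v≡b) = inPM v b vb
  in Reach-deleteVertex-cong H v M′v≡b Mv≡c (AlternatingWalk.alternating-walk H v M M′ fin)

module _ (G : Graph) (u : V G) (H : Graph) (v : V H) (f : V G → V H) where
  private
    S : Graph
    S = splice G u H v f

  Adj-splice-cross : (x : Sub G u) (y : Sub H v)
    → Adj S (inj₁ x) (inj₂ y) ⇔ (Adj G u (proj₁ x) × Adj H v (proj₁ y) × f (proj₁ x) ≡ proj₁ y)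
  Adj-splice-cross (x , _) (y , _) = mk⇔
    (λ t → let (ux , rest) = Equivalence.to T-∧ t
               (vy , fx≡y) = Equivalence.to T-∧ rest
           in ux , vy , toWitness {a? = (_≟_ H) (f x) y} fx≡y)
    (λ (ux , vy , fx≡y) →
      Equivalence.from T-∧ (ux , Equivalence.from T-∧ (vy , fromWitness {a? = (_≟_ H) (f x) y} fx≡y)))

  Reach-inj₁ : ∀ {x y} → Reach (deleteVertex G u) x y → Reach S (inj₁ x) (inj₁ y)
  Reach-inj₁ = Reach-map inj₁ id

  Reach-inj₂ : ∀ {x y} → Reach (deleteVertex H v) x y → Reach S (inj₂ x) (inj₂ y)
  Reach-inj₂ = Reach-map inj₂ id

  module GlueMatchings (M : PerfectMatching G) (N : PerfectMatching H) (fit : f (proj₁ M u) ≡ proj₁ N v) where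
    private
      open Graph G using () renaming (_≟_ to _≟G_)
      open Graph H using () renaming (_≟_ to _≟H_)
      μ : V G → V G
      μ = proj₁ M
      ν : V H → V H
      ν = proj₁ N

      μu : Sub G u
      μu = μ u , adj⇒≠ G u _ (PM-adj G M u)
      νv : Sub H v
      νv = ν v , adj⇒≠ H v _ (PM-adj H N v)

      partner₁ : (x : V G) → Dec (μ x ≡ u) → V S
      partner₁ x (yes _)    = inj₂ νv
      partner₁ x (no μx≢u) = inj₁ (sub G μx≢u)

      partner₂ : (y : V H) → Dec (ν y ≡ v) → V S
      partner₂ y (yes _)    = inj₁ μu
      partner₂ y (no νy≢v) = inj₂ (sub H νy≢v)

    glued : V S → V S
    glued (inj₁ (x , _)) = partner₁ x (μ x ≟G u)
    glued (inj₂ (y , _)) = partner₂ y (ν y ≟H v)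

    private
      x≡μu : ∀ {x} → μ x ≡ u → x ≡ μ u
      x≡μu {x} μx≡u = trans (sym (PM-involutive G M x)) (cong μ μx≡u)

      y≡νv : ∀ {y} → ν y ≡ v → y ≡ ν v
      y≡νv {y} νy≡v = trans (sym (PM-involutive H N y)) (cong ν νy≡v)

    glued-adj : ∀ w → Adj S w (glued w)
    glued-adj (inj₁ (x , p)) with μ x ≟G u
    ... | yes μx≡u = Equivalence.from (Adj-splice-cross (x , p) νv)
          ( subst (Adj G u) (sym (x≡μu μx≡u)) (PM-adj G M u)
          , PM-adj H N v
          , trans (cong f (x≡μu μx≡u)) fit )
    ... | no _ = PM-adj G M x
    glued-adj (inj₂ (y , q)) with ν y ≟H v
    ... | yes νy≡v = Equivalence.from (Adj-splice-cross μu (y , q))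
          ( PM-adj G M u
          , subst (Adj H v) (sym (y≡νv νy≡v)) (PM-adj H N v)
          , trans fit (sym (y≡νv νy≡v)) )
    ... | no _ = PM-adj H N y

    glued-involutive : ∀ w → glued (glued w) ≡ w
    glued-involutive (inj₁ (x , p)) with μ x ≟G u
    ... | yes μx≡u with ν (ν v) ≟H v
    ...   | yes _     = cong inj₁ (Sub-≡ {G} (sym (x≡μu μx≡u)))
    ...   | no ννv≢v = ⊥-elim (ννv≢v (PM-involutive H N v))
    glued-involutive (inj₁ (x , p)) | no _ with μ (μ x) ≟G u
    ...   | yes μμx≡u = ⊥-elim (Sub-≢ {G} (x , p) (trans (sym (PM-involutive G M x)) μμx≡u))
    ...   | no _      = cong inj₁ (Sub-≡ {G} (PM-involutive G M x))
    glued-involutive (inj₂ (y , q)) with ν y ≟H v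
    ... | yes νy≡v with μ (μ u) ≟G u
    ...   | yes _     = cong inj₂ (Sub-≡ {H} (sym (y≡νv νy≡v)))
    ...   | no μμu≢u = ⊥-elim (μμu≢u (PM-involutive G M u))
    glued-involutive (inj₂ (y , q)) | no _ with ν (ν y) ≟H v
    ...   | yes ννy≡v = ⊥-elim (Sub-≢ {H} (y , q) (trans (sym (PM-involutive H N y)) ννy≡v))
    ...   | no _      = cong inj₂ (Sub-≡ {H} (PM-involutive H N y))

    matching : PerfectMatching S
    matching = glued , glued-adj , glued-involutive

    glued-inside₁ : (x y : Sub G u) → μ (proj₁ x) ≡ proj₁ y → glued (inj₁ x) ≡ inj₁ y
    glued-inside₁ (x , _) y μx≡y with μ x ≟G u
    ... | yes μx≡u = ⊥-elim (Sub-≢ {G} y (trans (sym μx≡y) μx≡u))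
    ... | no _     = cong inj₁ (Sub-≡ {G} μx≡y)

    glued-inside₂ : (x y : Sub H v) → ν (proj₁ x) ≡ proj₁ y → glued (inj₂ x) ≡ inj₂ y
    glued-inside₂ (x , _) y νx≡y with ν x ≟H v
    ... | yes νx≡v = ⊥-elim (Sub-≢ {H} y (trans (sym νx≡y) νx≡v))
    ... | no _     = cong inj₂ (Sub-≡ {H} νx≡y)

    glued-cross : (x : Sub G u) (y : Sub H v)
      → μ u ≡ proj₁ x → ν v ≡ proj₁ y → glued (inj₁ x) ≡ inj₂ y
    glued-cross (x , _) y μu≡x νv≡y with μ x ≟G u
    ... | yes _    = cong inj₂ (Sub-≡ {H} νv≡y)
    ... | no μx≢u = ⊥-elim (μx≢u (trans (cong μ (sym μu≡x)) (PM-involutive G M u)))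

module _ (G : Graph) (u : V G) (H : Graph) (v : V H) (f : V G → V H)
         (corr : Correspondence G u H v f) (mcG : MatchingCovered G) (mcH : MatchingCovered H) where
  private
    S : Graph
    S = splice G u H v f

    module Gl = GlueMatchings G u H v f

    f-adj : ∀ x → Adj G u x → Adj H v (f x)
    f-adj = proj₁ corr

    f-onto : ∀ y → Adj H v y → Σ (V G) λ x → Adj G u x × f x ≡ y
    f-onto = proj₂ (proj₂ corr)

    inPM-G : ∀ x y → Adj G x y → InSomePM G x y
    inPM-G = proj₂ (proj₂ mcG)

    inPM-H : ∀ x y → Adj H x y → InSomePM H x y
    inPM-H = proj₂ (proj₂ mcH)

    f-sub : (x : V G) → Adj G u x → Sub H v
    f-sub x ux = f x , adj⇒≠ H v _ (f-adj x ux)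

    cross-edge : (x : Sub G u) (ux : Adj G u (proj₁ x)) → Adj S (inj₁ x) (inj₂ (f-sub _ ux))
    cross-edge x ux = Equivalence.from (Adj-splice-cross G u H v f x (f-sub _ ux)) (ux , f-adj _ ux , refl)

    inSomePM-cross : (x : Sub G u) (y : Sub H v) → Adj S (inj₁ x) (inj₂ y) → InSomePM S (inj₁ x) (inj₂ y)
    inSomePM-cross x y xy with Equivalence.to (Adj-splice-cross G u H v f x y) xy
    ... | ux , vy , fx≡y with inPM-G u _ ux | inPM-H v _ vy
    ...   | M , μu≡x | N , νv≡y = Gl.matching M N fit , Gl.glued-cross M N fit x y μu≡x νv≡y
      where
        fit : f (proj₁ M u) ≡ proj₁ N v
        fit = trans (cong f μu≡x) (trans fx≡y (sym νv≡y))

  splice-inSomePM : ∀ w w′ → Adj S w w′ → InSomePM S w w′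
  splice-inSomePM (inj₁ x) (inj₁ y) xy with inPM-G _ _ xy
  ... | M , μx≡y with inPM-H v (f (proj₁ M u)) (f-adj _ (PM-adj G M u))
  ...   | N , νv≡fμu = Gl.matching M N (sym νv≡fμu) , Gl.glued-inside₁ M N (sym νv≡fμu) x y μx≡y
  splice-inSomePM (inj₁ x) (inj₂ y) xy = inSomePM-cross x y xy
  splice-inSomePM (inj₂ y) (inj₁ x) yx =
    let (P , Px≡y) = inSomePM-cross x y yx
    in P , trans (cong (proj₁ P) (sym Px≡y)) (PM-involutive S P (inj₁ x))
  splice-inSomePM (inj₂ x) (inj₂ y) xy with inPM-H _ _ xy
  ... | N , νx≡y with f-onto (proj₁ N v) (PM-adj H N v)
  ...   | a , ua , fa≡νv with inPM-G u a ua
  ...     | M , μu≡a = Gl.matching M N fit , Gl.glued-inside₂ M N fit x y νx≡y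
    where
      fit : f (proj₁ M u) ≡ proj₁ N v
      fit = trans (cong f μu≡a) fa≡νv

  private
    reaches-neighbour : ∀ w
      → Σ (V H) λ b → Σ (Adj H v b) λ vb → Reach S w (inj₂ (b , adj⇒≠ H v b vb))
    reaches-neighbour (inj₂ y) =
      let (b , vb , y→b) = reach-neighbour H v y (proj₁ mcH (proj₁ y) v)
      in b , vb , Reach-inj₂ G u H v f y→b
    reaches-neighbour (inj₁ x) =
      let (a , ua , x→a) = reach-neighbour G u x (proj₁ mcG (proj₁ x) u)
      in f a , f-adj a ua , Reach-snoc S (Reach-inj₁ G u H v f x→a) (cross-edge (a , adj⇒≠ G u a ua) ua)

  splice-connected : Finite H → Connected S
  splice-connected finH w w′ =
    let (b , vb , w→b) = reaches-neighbour w
        (b′ , vb′ , w′→b′) = reaches-neighbour w′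
        b→b′ = Reach-inj₂ G u H v f (neighbours-linked H finH mcH vb vb′)
    in Reach-trans S w→b (Reach-trans S b→b′ (Reach-sym S w′→b′))

  splice-edge : Σ (V S) λ x → Σ (V S) λ y → Adj S x y
  splice-edge =
    let (x , y , xy) = proj₁ (proj₂ mcG)
        (M , _) = inPM-G x y xy
        uμu = PM-adj G M u
        μu = proj₁ M u , adj⇒≠ G u _ uμu
    in inj₁ μu , inj₂ (f-sub _ uμu) , cross-edge μu uμu

  splice-matchingCovered : Finite H → MatchingCovered S
  splice-matchingCovered finH = splice-connected finH , splice-edge , splice-inSomePM

module _ (A : Graph) (w : V A) (B : Graph) (z : V B) (f : V A → V B) (p q : Sub A w) where
  private
    A′ : Graph
    A′ = deleteEdge A (proj₁ p) (proj₁ q)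

    S S′ : Graph
    S = splice A w B z f
    S′ = splice A′ w B z f

    Adj-A′-w : ∀ {x} → Adj A′ w x ⇔ Adj A w x
    Adj-A′-w = Adj-deleteEdge-away A (Sub-≢ {A} p ∘ sym) (Sub-≢ {A} q ∘ sym)

  Correspondence-deleteEdge : Correspondence A w B z f → Correspondence A′ w B z f
  Correspondence-deleteEdge (f-adj , f-inj , f-onto) =
    (λ x wx → f-adj x (Equivalence.to Adj-A′-w wx)) ,
    (λ x y wx wy → f-inj x y (Equivalence.to Adj-A′-w wx) (Equivalence.to Adj-A′-w wy)) ,
    (λ y zy → let (x , wx , fx≡y) = f-onto y zy in x , Equivalence.from Adj-A′-w wx , fx≡y)

  private
    Adj-cross-S⇔S′ : (x : Sub A w) (y : Sub B z)
      → Adj S (inj₁ x) (inj₂ y) ⇔ Adj S′ (inj₁ x) (inj₂ y)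
    Adj-cross-S⇔S′ x y = mk⇔
      (λ xy → let (wx , zy , fx≡y) = Equivalence.to (Adj-splice-cross A w B z f x y) xy
              in Equivalence.from (Adj-splice-cross A′ w B z f x y) (Equivalence.from Adj-A′-w wx , zy , fx≡y))
      (λ xy → let (wx , zy , fx≡y) = Equivalence.to (Adj-splice-cross A′ w B z f x y) xy
              in Equivalence.from (Adj-splice-cross A w B z f x y) (Equivalence.to Adj-A′-w wx , zy , fx≡y))

    P Q : V S
    P = inj₁ p
    Q = inj₁ q

    raise : ∀ {r s}
      → SameEdge (proj₁ p) (proj₁ q) (proj₁ r) (proj₁ s) → SameEdge P Q (inj₁ r) (inj₁ s)
    raise = SameEdge-map inj₁ ∘ SameEdge-reflect (Sub-≡ {A})

    lower : ∀ {r s}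
      → SameEdge P Q (inj₁ r) (inj₁ s) → SameEdge (proj₁ p) (proj₁ q) (proj₁ r) (proj₁ s)
    lower = SameEdge-map proj₁ ∘ SameEdge-reflect inj₁-injective

    to-hom : Homomorphism S′ (deleteEdge S P Q) id
    to-hom {inj₁ r} {inj₁ s} h =
      let (rs , ¬same) = Equivalence.to (Adj-deleteEdge A (proj₁ p) (proj₁ q) (proj₁ r) (proj₁ s)) h
      in Equivalence.from (Adj-deleteEdge S P Q (inj₁ r) (inj₁ s)) (rs , ¬same ∘ lower)
    to-hom {inj₁ r} {inj₂ s} h = Equivalence.from (Adj-deleteEdge S P Q (inj₁ r) (inj₂ s))
      (Equivalence.from (Adj-cross-S⇔S′ r s) h , [ (λ ()) ∘ proj₂ , (λ ()) ∘ proj₂ ])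
    to-hom {inj₂ s} {inj₁ r} h = Equivalence.from (Adj-deleteEdge S P Q (inj₂ s) (inj₁ r))
      (Equivalence.from (Adj-cross-S⇔S′ r s) h , [ (λ ()) ∘ proj₁ , (λ ()) ∘ proj₁ ])
    to-hom {inj₂ r} {inj₂ s} h = Equivalence.from (Adj-deleteEdge S P Q (inj₂ r) (inj₂ s))
      (h , [ (λ ()) ∘ proj₁ , (λ ()) ∘ proj₁ ])

    from-hom : Homomorphism (deleteEdge S P Q) S′ id
    from-hom {inj₁ r} {inj₁ s} h =
      let (rs , ¬same) = Equivalence.to (Adj-deleteEdge S P Q (inj₁ r) (inj₁ s)) h
      in Equivalence.from (Adj-deleteEdge A (proj₁ p) (proj₁ q) (proj₁ r) (proj₁ s)) (rs , ¬same ∘ raise)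
    from-hom {inj₁ r} {inj₂ s} h =
      Equivalence.to (Adj-cross-S⇔S′ r s)
        (proj₁ (Equivalence.to (Adj-deleteEdge S P Q (inj₁ r) (inj₂ s)) h))
    from-hom {inj₂ s} {inj₁ r} h =
      Equivalence.to (Adj-cross-S⇔S′ r s)
        (proj₁ (Equivalence.to (Adj-deleteEdge S P Q (inj₂ s) (inj₁ r)) h))
    from-hom {inj₂ r} {inj₂ s} h = proj₁ (Equivalence.to (Adj-deleteEdge S P Q (inj₂ r) (inj₂ s)) h)

  splice-deleteEdge-≅ : S′ ≅ deleteEdge S P Q
  splice-deleteEdge-≅ = record
    { to = id ; from = id ; to-from = λ _ → refl ; from-to = λ _ → refl
    ; to-hom = λ {r} {s} → to-hom {r} {s} ; from-hom = λ {r} {s} → from-hom {r} {s} }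

Removable-splice : (A : Graph) (w : V A) (B : Graph) (z : V B) (f : V A → V B)
  → Correspondence A w B z f → MatchingCovered B → Finite B
  → (p q : Sub A w) → Removable A (proj₁ p) (proj₁ q) → Removable (splice A w B z f) (inj₁ p) (inj₁ q)
Removable-splice A w B z f corr mcB finB p q (pq , mc-A-pq) =
  pq , MatchingCovered-≅ (splice-deleteEdge-≅ A w B z f p q)
         (splice-matchingCovered (deleteEdge A (proj₁ p) (proj₁ q)) w B z f
           (Correspondence-deleteEdge A w B z f p q corr) mc-A-pq mcB finB)

module _ (G0 G1 G2 : Graph) (v1 v2 : V G0) (e : Adj G0 v1 v2) (u1 : V G1) (u2 : V G2)
         (f1 : V G0 → V G1) (f2 : V G0 → V G2) where
  private
    H : Graph
    H = H₁ G0 G1 G2 v1 v2 e u1 u2 f1 f2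
    w : V H
    w = v2' G0 G1 G2 v1 v2 e u1 u2 f1 f2
    g : V H → V G2
    g = f2' G0 G1 G2 v1 v2 e u1 u2 f1 f2
    v2-sub : Sub G0 v1
    v2-sub = v2 , adj⇒≠ G0 v1 v2 e

  f2′-correspondence : Correspondence G0 v1 G1 u1 f1 → Correspondence G0 v2 G2 u2 f2
    → Correspondence H w G2 u2 g
  f2′-correspondence (f1-adj , _ , _) (f2-adj , f2-inj , f2-onto) = g-adj , g-inj , g-onto
    where
      f1v2≡ : ∀ y → Adj H w (inj₂ y) → f1 v2 ≡ proj₁ y
      f1v2≡ y wy = proj₂ (proj₂ (Equivalence.to (Adj-splice-cross G0 v1 G1 u1 f1 v2-sub y) wy))

      g-adj : ∀ x → Adj H w x → Adj G2 u2 (g x)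
      g-adj (inj₁ (x , _)) wx = f2-adj x wx
      g-adj (inj₂ _) _ = f2-adj v1 (Adj-sym G0 e)

      g-inj : ∀ x y → Adj H w x → Adj H w y → g x ≡ g y → x ≡ y
      g-inj (inj₁ x) (inj₁ y) wx wy gx≡gy = cong inj₁ (Sub-≡ {G0} (f2-inj _ _ wx wy gx≡gy))
      g-inj (inj₁ x) (inj₂ _) wx _ gx≡gy = ⊥-elim (Sub-≢ {G0} x (f2-inj _ _ wx (Adj-sym G0 e) gx≡gy))
      g-inj (inj₂ _) (inj₁ y) _ wy gy≡gx = ⊥-elim (Sub-≢ {G0} y (f2-inj _ _ wy (Adj-sym G0 e) (sym gy≡gx)))
      g-inj (inj₂ x) (inj₂ y) wx wy _ = cong inj₂ (Sub-≡ {G1} (trans (sym (f1v2≡ x wx)) (f1v2≡ y wy)))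

      g-onto : ∀ z → Adj G2 u2 z → Σ (V H) λ x → Adj H w x × g x ≡ z
      g-onto z u2z with f2-onto z u2z
      ... | x , v2x , f2x≡z with (_≟_ G0) x v1
      ...   | yes refl =
        inj₂ f1v2 ,
        Equivalence.from (Adj-splice-cross G0 v1 G1 u1 f1 v2-sub f1v2) (e , f1-adj v2 e , refl) ,
        f2x≡z
        where
          f1v2 : Sub G1 u1
          f1v2 = f1 v2 , adj⇒≠ G1 u1 _ (f1-adj v2 e)
      ...   | no x≢v1 = inj₁ (sub G0 x≢v1) , v2x , f2x≡z

  removable-doubleSplice : Correspondence G0 v1 G1 u1 f1 → Correspondence G0 v2 G2 u2 f2
    → MatchingCovered G2 → Finite G2
    → (a b : Sub G1 u1) → Removable H (inj₂ a) (inj₂ b)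
    → Removable (doubleSplice G0 G1 G2 v1 v2 e u1 u2 f1 f2)
        (emb₁ G0 G1 G2 v1 v2 e u1 u2 f1 f2 a) (emb₁ G0 G1 G2 v1 v2 e u1 u2 f1 f2 b)
  removable-doubleSplice c1 c2 mc2 fin2 a b =
    Removable-splice H w G2 u2 g (f2′-correspondence c1 c2) mc2 fin2 (inj₂ a , _) (inj₂ b , _)

module DoubleSpliceSwap (G0 G1 G2 : Graph) (v1 v2 : V G0) (e : Adj G0 v1 v2) (e′ : Adj G0 v2 v1)
  (u1 : V G1) (u2 : V G2) (f1 : V G0 → V G1) (f2 : V G0 → V G2) where
  private
    D D′ H H′ : Graph
    D = doubleSplice G0 G1 G2 v1 v2 e u1 u2 f1 f2
    D′ = doubleSplice G0 G2 G1 v2 v1 e′ u2 u1 f2 f1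
    H = H₁ G0 G1 G2 v1 v2 e u1 u2 f1 f2
    H′ = H₁ G0 G2 G1 v2 v1 e′ u2 u1 f2 f1

    ∧-rearrange : (a a′ b c d e : Bool)
      → T a′ → T ((a ∧ b ∧ c) ∧ d ∧ e) → T ((a′ ∧ d ∧ e) ∧ b ∧ c)
    ∧-rearrange true true true true true true _ _ = _

  swap : V D → V D′
  swap (inj₁ (inj₁ x , x≢v2)) =
    inj₁ (inj₁ x′ , fromWitnessFalse {a? = (_≟_ H′) (inj₁ x′) _} x′≢v1)
    where
      x′ : Sub G0 v2
      x′ = sub G0 (λ x≡v2 → Sub-≢ {H} (inj₁ x , x≢v2) (cong inj₁ (Sub-≡ {G0} x≡v2)))
      x′≢v1 : inj₁ x′ ≢ v2' G0 G2 G1 v2 v1 e′ u2 u1 f2 f1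
      x′≢v1 x′≡v1 = Sub-≢ {G0} x (cong proj₁ (inj₁-injective x′≡v1))
  swap (inj₁ (inj₂ y , _)) = inj₂ y
  swap (inj₂ z) = inj₁ (inj₂ z , _)

  -- An edge yz between G1 and G2 is encoded as (v1 ~ v2 ∧ y-part) ∧ z-part in one order of
  -- splicing and as (v2 ~ v1 ∧ z-part) ∧ y-part in the other; all other adjacencies coincide.
  swap-hom : Homomorphism D D′ swap
  swap-hom {inj₁ (inj₁ _ , _)} {inj₁ (inj₁ _ , _)} xy = xy
  swap-hom {inj₁ (inj₁ _ , _)} {inj₁ (inj₂ _ , _)} xy = xy
  swap-hom {inj₁ (inj₁ _ , _)} {inj₂ _} xy = xy
  swap-hom {inj₁ (inj₂ _ , _)} {inj₁ (inj₁ _ , _)} xy = xy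
  swap-hom {inj₁ (inj₂ _ , _)} {inj₁ (inj₂ _ , _)} xy = xy
  swap-hom {inj₁ (inj₂ (y , _) , _)} {inj₂ (z , _)} xy =
    ∧-rearrange (adj G0 v1 v2) (adj G0 v2 v1) (adj G1 u1 y) _ (adj G2 u2 z) _ e′ xy
  swap-hom {inj₂ _} {inj₁ (inj₁ _ , _)} xy = xy
  swap-hom {inj₂ (z , _)} {inj₁ (inj₂ (y , _) , _)} xy =
    ∧-rearrange (adj G0 v1 v2) (adj G0 v2 v1) (adj G1 u1 y) _ (adj G2 u2 z) _ e′ xy
  swap-hom {inj₂ _} {inj₂ _} xy = xy

doubleSplice-swap-≅ : (G0 G1 G2 : Graph) (v1 v2 : V G0) (e : Adj G0 v1 v2) (e′ : Adj G0 v2 v1)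
  (u1 : V G1) (u2 : V G2) (f1 : V G0 → V G1) (f2 : V G0 → V G2)
  → doubleSplice G0 G2 G1 v2 v1 e′ u2 u1 f2 f1 ≅ doubleSplice G0 G1 G2 v1 v2 e u1 u2 f1 f2
doubleSplice-swap-≅ G0 G1 G2 v1 v2 e e′ u1 u2 f1 f2 = record
  { to = B.swap ; from = A.swap ; to-from = B∘A ; from-to = A∘B
  ; to-hom = λ {x} {y} → B.swap-hom {x} {y} ; from-hom = λ {x} {y} → A.swap-hom {x} {y} }
  where
    module A = DoubleSpliceSwap G0 G1 G2 v1 v2 e e′ u1 u2 f1 f2
    module B = DoubleSpliceSwap G0 G2 G1 v2 v1 e′ e u2 u1 f2 f1

    H H′ : Graph
    H = H₁ G0 G1 G2 v1 v2 e u1 u2 f1 f2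
    H′ = H₁ G0 G2 G1 v2 v1 e′ u2 u1 f2 f1

    B∘A : ∀ x → B.swap (A.swap x) ≡ x
    B∘A (inj₁ (inj₁ _ , _)) = cong inj₁ (Sub-≡ {H} (cong inj₁ (Sub-≡ {G0} refl)))
    B∘A (inj₁ (inj₂ _ , _)) = cong inj₁ (Sub-≡ {H} refl)
    B∘A (inj₂ _) = refl

    A∘B : ∀ x → A.swap (B.swap x) ≡ x
    A∘B (inj₁ (inj₁ _ , _)) = cong inj₁ (Sub-≡ {H′} (cong inj₁ (Sub-≡ {G0} refl)))
    A∘B (inj₁ (inj₂ _ , _)) = cong inj₁ (Sub-≡ {H′} refl)
    A∘B (inj₂ _) = refl

corollary2p18 : (G0 G1 G2 : Graph) → Finite G0 → Finite G1 → Finite G2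
    → MatchingCovered G0 → MatchingCovered G1 → MatchingCovered G2
    → (v1 v2 : V G0) (e : Adj G0 v1 v2) (u1 : V G1) (u2 : V G2)
    → (f1 : V G0 → V G1) (f2 : V G0 → V G2)
    → Correspondence G0 v1 G1 u1 f1 → Correspondence G0 v2 G2 u2 f2
    → ((a b : Sub G1 u1) → Removable (splice G0 v1 G1 u1 f1) (inj₂ a) (inj₂ b)
        → Removable (doubleSplice G0 G1 G2 v1 v2 e u1 u2 f1 f2) (emb₁ G0 G1 G2 v1 v2 e u1 u2 f1 f2 a) (emb₁ G0 G1 G2 v1 v2 e u1 u2 f1 f2 b))
      × ((a b : Sub G2 u2) → Removable (splice G0 v2 G2 u2 f2) (inj₂ a) (inj₂ b)
        → Removable (doubleSplice G0 G1 G2 v1 v2 e u1 u2 f1 f2) (emb₂ G0 G1 G2 v1 v2 e u1 u2 f1 f2 a) (emb₂ G0 G1 G2 v1 v2 e u1 u2 f1 f2 b))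
corollary2p18 G0 G1 G2 _ fin1 fin2 _ mc1 mc2 v1 v2 e u1 u2 f1 f2 c1 c2 =
  removable-doubleSplice G0 G1 G2 v1 v2 e u1 u2 f1 f2 c1 c2 mc2 fin2 ,
  λ a b → Removable-≅ (doubleSplice-swap-≅ G0 G1 G2 v1 v2 e e′ u1 u2 f1 f2)
            ∘ removable-doubleSplice G0 G2 G1 v2 v1 e′ u2 u1 f2 f1 c2 c1 mc1 fin1 a b
  where
    e′ : Adj G0 v2 v1
    e′ = Adj-sym G0 e
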